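{- Let $G$ be a graph, let $M$ be a mesh in $G$, let $G'$ be a minor of $G$, and let $M'$ be a mesh in $G'$ compatible with $M$. If for some integer $t\ge0$ the mesh $M'$ grasps a model of a $K_t$ minor of $G'$, then $M$ grasps a model of a $K_t$ minor of $G$.
   Context: Graphs are finite and may have loops and parallel edges. For integers $r,s\ge2$, an $r\times s$ mesh is a graph $M$ together with paths $P_1,\dots,P_r$ (horizontal paths) and $Q_1,\dots,Q_s$ (vertical paths) in $M$ such that for all $i\in\{1,\dots,r\}$, $j\in\{1,\dots,s\}$: (1) the $P_i$ are pairwise vertex-disjoint, the $Q_j$ are pairwise vertex-disjoint, and $M$ is the union of all $P_i$ and $Q_j$; (2) $P_i\cap Q_j$ is a path, which consists of exactly one vertex if $i\in\{1,r\}$ or $j\in\{1,s\}$; (3) $P_i$ has one end in $Q_1$ and the other in $Q_s$, and traversing $P_i$ one meets $Q_1,\dots,Q_s$ in this order; (4) $Q_j$ has one end in $P_1$ and the other in $P_r$, and traversing $Q_j$ one meets $P_1,\dots,P_r$ in this order. A mesh in $G$ is a subgraph of $G$ that is a mesh. A mesh $M'$ with horizontal paths $\mathcal H'$ and vertical paths $\mathcal V'$ is a submesh of a mesh $M$ with horizontal paths $\mathcal H$ and vertical paths $\mathcal V$ if every element of $\mathcal H'$ is a subpath of a distinct element of $\mathcal H$ and every element of $\mathcal V'$ is a subpath of a distinct element of $\mathcal V$. If $G'$ is a minor of $G$ and $M'$ is a mesh in $G'$, then $M'$ is compatible with $M$ if there exist $Z\subseteq E(G)$ and a submesh $\bar M$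 of $M$ such that $G'$ is obtained from a subgraph of $G$ by contracting $Z$ and $M'$ is obtained from $\bar M$ by contracting $Z\cap E(\bar M)$. A model of a $K_t$ minor in $G$ is a family of $t$ pairwise disjoint vertex sets (branch sets), each inducing a connected subgraph, with an edge of $G$ between every two of them; it is grasped by an $r\times s$ mesh $M$ if $t\le\min\{r,s\}$ and every branch set intersects at least $t$ horizontal paths or at least $t$ vertical paths of $M$. -}

module Defs where

open import Level using (0ℓ)
open import Data.Nat using (ℕ; zero; suc; _≤_; _<_)
open import Data.Fin using (Fin; toℕ; inject₁) renaming (zero to fzero; suc to fsuc)
open import Data.Product using (Σ; ∃; _×_; _,_; proj₁; proj₂)
open import Data.Sum using (_⊎_)
open import Data.Empty using (⊥)
open import Relation.Nullary using (¬_)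
open import Relation.Unary using (Pred; _∈_)
open import Relation.Binary.PropositionalEquality using (_≡_; _≢_)
open import Relation.Binary.Construct.Closure.ReflexiveTransitive using (Star)
open import Function.Definitions using (Injective)
open import Function.Bundles using (_⇔_)

-- Finite graphs, loops and parallel edges allowed.
-- Vertices are Fin nV, edges are Fin nE; each edge has two ends
-- (an ordered pair, read as unordered via Joins; a loop has equal ends).

record Graph : Set where
  field
    nV   : ℕ
    nE   : ℕ
    ends : Fin nE → Fin nV × Fin nV

open Graph public

Vtx : Graph → Set
Vtx G = Fin (nV G)

Edg : Graph → Set
Edg G = Fin (nE G)

Joins : (G : Graph) → Edg G → Vtx G → Vtx G → Set
Joins G e u v = ends G e ≡ (u , v) ⊎ ends G e ≡ (v , u)

record Path (G : Graph) : Set where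
  field
    len   : ℕ
    vtx   : Fin (suc len) → Vtx G
    edg   : Fin len → Edg G
    inj   : Injective _≡_ _≡_ vtx
    links : ∀ k → Joins G (edg k) (vtx (inject₁ k)) (vtx (fsuc k))

open Path public

VP : {G : Graph} → Path G → Pred (Vtx G) 0ℓ
VP p v = ∃ λ k → vtx p k ≡ v

EP : {G : Graph} → Path G → Pred (Edg G) 0ℓ
EP p e = ∃ λ k → edg p k ≡ e

startV : {G : Graph} → Path G → Vtx G
startV p = vtx p fzero

endV : {G : Graph} → (p : Path G) → Vtx G
endV p = vtx p (Data.Fin.fromℕ (len p))

SubPath : {G : Graph} → Path G → Path G → Set
SubPath p q = (∀ v → VP p v → VP q v) × (∀ e → EP p e → EP q e)

-- "traversing p one meets Q_1,…,Q_s in this order", with one end of p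
-- in Q_1 and the other in Q_s (p may be traversed in either direction)
Traverses : {G : Graph} {s : ℕ} → Path G → (Fin s → Path G) → Set
Traverses {G} {s} p Q =
    ( (∀ j → toℕ j ≡ 0 → VP (Q j) (startV p))
    × (∀ j → suc (toℕ j) ≡ s → VP (Q j) (endV p))
    × (∀ a b j j' → VP (Q j) (vtx p a) → VP (Q j') (vtx p b)
         → toℕ j < toℕ j' → toℕ a < toℕ b) )
  ⊎ ( (∀ j → suc (toℕ j) ≡ s → VP (Q j) (startV p))
    × (∀ j → toℕ j ≡ 0 → VP (Q j) (endV p))
    × (∀ a b j j' → VP (Q j) (vtx p a) → VP (Q j') (vtx p b)
         → toℕ j < toℕ j' → toℕ b < toℕ a) )

-- i ∈ {1, r} (0-based: toℕ i ∈ {0, r-1})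
Boundary : {r : ℕ} → Fin r → Set
Boundary {r} i = toℕ i ≡ 0 ⊎ suc (toℕ i) ≡ r

-- Meshes in G.  The mesh (as a subgraph of G) is the union of its
-- horizontal paths P i and vertical paths Q j.

record Mesh (G : Graph) : Set where
  field
    r     : ℕ
    s     : ℕ
    2≤r   : 2 ≤ r
    2≤s   : 2 ≤ s
    P     : Fin r → Path G
    Q     : Fin s → Path G
    P-disj : ∀ i i' → i ≢ i' → ∀ v → VP (P i) v → VP (P i') v → ⊥
    Q-disj : ∀ j j' → j ≢ j' → ∀ v → VP (Q j) v → VP (Q j') v → ⊥
    -- (2) P i ∩ Q j is a path, a single vertex on the boundary
    cross  : ∀ i j → Σ (Path G) λ R →
               (∀ v → VP R v ⇔ (VP (P i) v × VP (Q j) v))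
             × (∀ e → EP R e ⇔ (EP (P i) e × EP (Q j) e))
             × (Boundary i ⊎ Boundary j → len R ≡ 0)
    P-trav : ∀ i → Traverses (P i) Q
    Q-trav : ∀ j → Traverses (Q j) P

open Mesh public

VM : {G : Graph} → Mesh G → Pred (Vtx G) 0ℓ
VM M v = (∃ λ i → VP (P M i) v) ⊎ (∃ λ j → VP (Q M j) v)

EM : {G : Graph} → Mesh G → Pred (Edg G) 0ℓ
EM M e = (∃ λ i → EP (P M i) e) ⊎ (∃ λ j → EP (Q M j) e)

Submesh : {G : Graph} → Mesh G → Mesh G → Set
Submesh M' M =
    (Σ (Fin (r M') → Fin (r M)) λ σ → Injective _≡_ _≡_ σ
        × (∀ i → SubPath (P M' i) (P M (σ i))))
  × (Σ (Fin (s M') → Fin (s M)) λ τ → Injective _≡_ _≡_ τ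
        × (∀ j → SubPath (Q M' j) (Q M (τ j))))

Adj : (G : Graph) → Pred (Edg G) 0ℓ → Vtx G → Vtx G → Set
Adj G A u v = ∃ λ e → A e × Joins G e u v

Linked : (G : Graph) → Pred (Edg G) 0ℓ → Vtx G → Vtx G → Set
Linked G A = Star (Adj G A)

-- G' is obtained from the subgraph (SV, SE) of G by contracting Z ⊆ E(G)
-- (i.e. the edges of Z lying in the subgraph): φ maps the vertices of the
-- subgraph onto V(G'), identifying exactly the vertices linked by
-- Z-edges of the subgraph, and ψ is a bijection from the remaining edges
-- of the subgraph onto E(G'), compatible with ends.
record Contraction (G G' : Graph) : Set₁ where
  field
    SV      : Pred (Vtx G) 0ℓ
    SE      : Pred (Edg G) 0ℓ
    Z       : Pred (Edg G) 0ℓ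
    SE-ends : ∀ e → SE e → SV (proj₁ (ends G e)) × SV (proj₂ (ends G e))
    φ       : Vtx G → Vtx G'
    ψ       : Edg G → Edg G'
    φ-onto  : ∀ w → ∃ λ v → SV v × φ v ≡ w
    φ-fibre : ∀ u v → SV u → SV v →
                (φ u ≡ φ v) ⇔ Linked G (λ e → SE e × Z e) u v
    ψ-inj   : ∀ e f → SE e → ¬ Z e → SE f → ¬ Z f → ψ e ≡ ψ f → e ≡ f
    ψ-onto  : ∀ e' → ∃ λ e → SE e × ¬ Z e × ψ e ≡ e'
    ψ-ends  : ∀ e → SE e → ¬ Z e →
                Joins G' (ψ e) (φ (proj₁ (ends G e))) (φ (proj₂ (ends G e)))

open Contraction public

IsMinor : Graph → Graph → Set₁
IsMinor G' G = Contraction G G'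

ImV : {G G' : Graph} → Contraction G G' → Pred (Vtx G) 0ℓ → Pred (Vtx G') 0ℓ
ImV C X w = ∃ λ v → X v × φ C v ≡ w

ImE : {G G' : Graph} → Contraction G G' → Pred (Edg G) 0ℓ → Pred (Edg G') 0ℓ
ImE C A e' = ∃ λ e → A e × ¬ Z C e × ψ C e ≡ e'

-- M' (a mesh in G') is obtained from the mesh Mb of G (lying in the
-- subgraph of C) by contracting Z ∩ E(Mb): vertices of Mb are identified
-- exactly when linked by edges of Z ∩ E(Mb), and the i-th horizontal /
-- j-th vertical path of M' is the contraction of the i-th horizontal /
-- j-th vertical path of Mb.
ContractsTo : {G G' : Graph} → Contraction G G' → Mesh G → Mesh G' → Set
ContractsTo {G} {G'} C Mb M' =
    (∀ v → VM Mb v → SV C v)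
  × (∀ e → EM Mb e → SE C e)
  × (∀ u v → VM Mb u → VM Mb v →
       (φ C u ≡ φ C v) ⇔ Linked G (λ e → EM Mb e × Z C e) u v)
  × (r M' ≡ r Mb) × (s M' ≡ s Mb)
  × (∀ (i : Fin (r M')) (i' : Fin (r Mb)) → toℕ i ≡ toℕ i' →
       (∀ w → VP (P M' i) w ⇔ ImV C (VP (P Mb i')) w)
     × (∀ e → EP (P M' i) e ⇔ ImE C (EP (P Mb i')) e))
  × (∀ (j : Fin (s M')) (j' : Fin (s Mb)) → toℕ j ≡ toℕ j' →
       (∀ w → VP (Q M' j) w ⇔ ImV C (VP (Q Mb j')) w)
     × (∀ e → EP (Q M' j) e ⇔ ImE C (EP (Q Mb j')) e))

Compatible : {G G' : Graph} → Mesh G → Mesh G' → Set₁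
Compatible {G} {G'} M M' =
  Σ (Contraction G G') λ C → Σ (Mesh G) λ Mb → Submesh Mb M × ContractsTo C Mb M'

record KModel (G : Graph) (t : ℕ) : Set₁ where
  field
    B         : Fin t → Pred (Vtx G) 0ℓ
    disjoint  : ∀ a b → a ≢ b → ∀ v → B a v → B b v → ⊥
    nonempty  : ∀ a → ∃ λ v → B a v
    connected : ∀ a u v → B a u → B a v →
                  Linked G (λ e → B a (proj₁ (ends G e)) × B a (proj₂ (ends G e))) u v
    adjacent  : ∀ a b → a ≢ b → ∃ λ e → Σ (Vtx G) λ u → Σ (Vtx G) λ v →
                  B a u × B b v × Joins G e u v

open KModel public

MeetsAtLeast : {G : Graph} {n : ℕ} → ℕ → Pred (Vtx G) 0ℓ → (Fin n → Path G) → Set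
MeetsAtLeast {G} {n} t X R =
  Σ (Fin t → Fin n) λ f → Injective _≡_ _≡_ f × (∀ k → ∃ λ v → X v × VP (R (f k)) v)

Grasps : {G : Graph} {t : ℕ} → Mesh G → KModel G t → Set
Grasps {G} {t} M K =
  t ≤ r M × t ≤ s M ×
  (∀ a → MeetsAtLeast t (B K a) (P M) ⊎ MeetsAtLeast t (B K a) (Q M))

module Submission where

-- Let M' be compatible with M via a contraction C of a
-- subgraph of G onto G' and a submesh Mb of M whose contraction is M'.
-- A K_t model of G' pulls back along C: the branch set of a is the set of
-- vertices of the contracted subgraph that C maps into the branch set of
-- a in G'.  Each fibre of C is connected by contracted edges, and every
-- edge of G' is the image of an uncontracted edge, so the preimages are
-- again connected, pairwise disjoint, nonempty and pairwise adjacent.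
-- Grasping transfers too: a branch set meeting the i-th path of M' meets
-- the i-th path of Mb (the preimage of that path), hence the path of M
-- containing it; the paths of Mb sit in distinct paths of M, so t distinct
-- paths of M' give t distinct paths of M, and t ≤ r M' = r Mb ≤ r M.

open import Defs
open import Level using (0ℓ)
open import Data.Nat using (ℕ; _≤_)
open import Data.Nat.Properties using (≤-trans)
open import Data.Fin using (Fin; toℕ)
open import Data.Fin.Properties using (injective⇒≤)
open import Data.Product using (Σ; ∃; _×_; _,_; proj₁; proj₂)
open import Data.Product.Properties using (,-injectiveˡ; ,-injectiveʳ)
open import Data.Sum using (_⊎_; inj₁; inj₂)
open import Relation.Unary using (Pred)
open import Relation.Binary.PropositionalEquality
  using (_≡_; _≢_; refl; sym; trans; subst)
open import Relation.Binary.Construct.Closure.ReflexiveTransitive using (ε; _◅_; _◅◅_)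
open import Function.Bundles using (Equivalence; _⇔_)
open import Function.Definitions using (Injective)

Induced : (H : Graph) → Pred (Vtx H) 0ℓ → Pred (Edg H) 0ℓ
Induced H X e = X (proj₁ (ends H e)) × X (proj₂ (ends H e))

joins⇒induced : ∀ (H : Graph) (X : Pred (Vtx H) 0ℓ) {e u v} →
                Joins H e u v → X u → X v → Induced H X e
joins⇒induced H X (inj₁ refl) xu xv = xu , xv
joins⇒induced H X (inj₂ refl) xu xv = xv , xu

induced⇒joined : ∀ (H : Graph) (X : Pred (Vtx H) 0ℓ) {e u v} →
                 Joins H e u v → Induced H X e → X u × X v
induced⇒joined H X (inj₁ refl) (x₁ , x₂) = x₁ , x₂
induced⇒joined H X (inj₂ refl) (x₁ , x₂) = x₂ , x₁

joins-unique : ∀ (H : Graph) {e u v x y} → Joins H e u v → Joins H e x y →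
               (x ≡ u × y ≡ v) ⊎ (x ≡ v × y ≡ u)
joins-unique H (inj₁ p) (inj₁ q) = let eq = trans (sym q) p in inj₁ (,-injectiveˡ eq , ,-injectiveʳ eq)
joins-unique H (inj₁ p) (inj₂ q) = let eq = trans (sym q) p in inj₂ (,-injectiveʳ eq , ,-injectiveˡ eq)
joins-unique H (inj₂ p) (inj₁ q) = let eq = trans (sym q) p in inj₂ (,-injectiveˡ eq , ,-injectiveʳ eq)
joins-unique H (inj₂ p) (inj₂ q) = let eq = trans (sym q) p in inj₁ (,-injectiveʳ eq , ,-injectiveˡ eq)

module Pullback {G G' : Graph} (C : Contraction G G') where

  Preimage : Pred (Vtx G') 0ℓ → Pred (Vtx G) 0ℓ
  Preimage X' v = SV C v × X' (φ C v)

  lift-edge : ∀ {e' u' v'} → Joins G' e' u' v' →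
              ∃ λ e → Σ (Vtx G) λ u → Σ (Vtx G) λ v →
                SV C u × SV C v × φ C u ≡ u' × φ C v ≡ v' × Joins G e u v
  lift-edge {e'} j' with ψ-onto C e'
  ... | e , se , nz , refl with SE-ends C e se | joins-unique G' j' (ψ-ends C e se nz)
  ...   | s₁ , s₂ | inj₁ (m₁ , m₂) = e , _ , _ , s₁ , s₂ , m₁ , m₂ , inj₁ refl
  ...   | s₁ , s₂ | inj₂ (m₁ , m₂) = e , _ , _ , s₂ , s₁ , m₂ , m₁ , inj₂ refl

  contracted-step : ∀ {x y} → SV C x → Adj G (λ e → SE C e × Z C e) x y →
                    SV C y × φ C x ≡ φ C y
  contracted-step {x} {y} sx step@(e , (se , _) , j) =
    sy , Equivalence.from (φ-fibre C x y sx sy) (step ◅ ε)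
    where
    sy : SV C y
    sy = proj₂ (induced⇒joined G (SV C) j (SE-ends C e se))

  module _ (X' : Pred (Vtx G') 0ℓ) where

    contracted-walk : ∀ {x y} → Preimage X' x →
                      Linked G (λ e → SE C e × Z C e) x y → Linked G (Induced G (Preimage X')) x y
    contracted-walk px ε = ε
    contracted-walk (sx , x'x) (step@(e , _ , j) ◅ rest) =
      let (sy , φx≡φy) = contracted-step sx step
          py = sy , subst X' φx≡φy x'x
      in (e , joins⇒induced G (Preimage X') j (sx , x'x) py , j) ◅ contracted-walk py rest

    fibre-linked : ∀ {x y} → Preimage X' x → SV C y → φ C x ≡ φ C y →
                   Linked G (Induced G (Preimage X')) x y
    fibre-linked {x} {y} px sy eq =
      contracted-walk px (Equivalence.to (φ-fibre C x y (proj₁ px) sy) eq)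

    lift-walk : ∀ {u' v'} → Linked G' (Induced G' X') u' v' →
                ∀ {x} → SV C x → φ C x ≡ u' →
                ∃ λ y → SV C y × φ C y ≡ v' × Linked G (Induced G (Preimage X')) x y
    lift-walk ε {x} sx refl = x , sx , refl , ε
    lift-walk ((e' , in' , j') ◅ rest) sx refl
      with lift-edge j' | induced⇒joined G' X' j' in'
    ... | e , u , v , su , sv , φu≡φx , refl , j | x'x , x'v =
      let (y , sy , φy , walk) = lift-walk rest sv refl
          pu = su , subst X' (sym φu≡φx) x'x
          uv-inside = joins⇒induced G (Preimage X') j pu (sv , x'v)
      in y , sy , φy , (fibre-linked (sx , x'x) su (sym φu≡φx) ◅◅ ((e , uv-inside , j) ◅ walk))

    preimage-connected :
      (∀ u' v' → X' u' → X' v' → Linked G' (Induced G' X') u' v') →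
      ∀ u v → Preimage X' u → Preimage X' v → Linked G (Induced G (Preimage X')) u v
    preimage-connected conn u v (su , x'u) (sv , x'v) =
      let (y , sy , φy≡φv , walk) = lift-walk (conn _ _ x'u x'v) su refl
      in walk ◅◅ fibre-linked (sy , subst X' (sym φy≡φv) x'v) sv φy≡φv

  pullback-model : ∀ {t} → KModel G' t → KModel G t
  pullback-model K' = record
    { B         = λ a → Preimage (B K' a)
    ; disjoint  = λ a b a≢b v pa pb → disjoint K' a b a≢b (φ C v) (proj₂ pa) (proj₂ pb)
    ; nonempty  = nonempty′
    ; connected = λ a → preimage-connected (B K' a) (connected K' a)
    ; adjacent  = adjacent′
    }
    where
    nonempty′ : ∀ a → ∃ λ v → Preimage (B K' a) v
    nonempty′ a with nonempty K' a
    ... | w , bw with φ-onto C w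
    ...   | v , sv , refl = v , sv , bw

    adjacent′ : ∀ a b → a ≢ b → ∃ λ e → Σ (Vtx G) λ u → Σ (Vtx G) λ v →
                Preimage (B K' a) u × Preimage (B K' b) v × Joins G e u v
    adjacent′ a b a≢b with adjacent K' a b a≢b
    ... | e' , u' , v' , bu , bv , j' with lift-edge j'
    ...   | e , u , v , su , sv , refl , refl , j = e , u , v , (su , bu) , (sv , bv) , j

meets-along : ∀ {H H' : Graph} {n m t : ℕ} {X : Pred (Vtx H) 0ℓ} {Y : Pred (Vtx H') 0ℓ}
  {R : Fin n → Path H} {S : Fin m → Path H'} (κ : Fin n → Fin m) → Injective _≡_ _≡_ κ →
  (∀ i v → X v → VP (R i) v → ∃ λ u → Y u × VP (S (κ i)) u) →
  MeetsAtLeast t X R → MeetsAtLeast t Y S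
meets-along κ κ-inj transfer (f , f-inj , hit) =
  (λ k → κ (f k)) , (λ eq → f-inj (κ-inj eq)) ,
  λ k → let (v , xv , onR) = hit k in transfer (f k) v xv onR

meets-pullback : ∀ {G G' : Graph} (C : Contraction G G') {n' n m t : ℕ}
  {X' : Pred (Vtx G') 0ℓ} (R' : Fin n' → Path G') (Rb : Fin n → Path G) (R : Fin m → Path G) →
  n' ≡ n → (σ : Fin n → Fin m) → Injective _≡_ _≡_ σ → (∀ i → SubPath (Rb i) (R (σ i))) →
  (∀ i v → VP (Rb i) v → SV C v) →
  (∀ (i : Fin n') (i' : Fin n) → toℕ i ≡ toℕ i' →
     ∀ w → VP (R' i) w ⇔ ImV C (VP (Rb i')) w) →
  MeetsAtLeast t X' R' → MeetsAtLeast t (Pullback.Preimage C X') R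
meets-pullback C {X' = X'} R' Rb R refl σ σ-inj sub inSV corr =
  meets-along {R = R'} {S = R} σ σ-inj transfer
  where
  open Pullback C using (Preimage)
  transfer : ∀ i w → X' w → VP (R' i) w → ∃ λ v → Preimage X' v × VP (R (σ i)) v
  transfer i w x'w onR' with Equivalence.to (corr i i refl w) onR'
  ... | v , onRb , refl = v , (inSV i v onRb , x'w) , proj₁ (sub i) v onRb

lemma3p5 : (G G' : Graph) (M : Mesh G) (M' : Mesh G') →
             IsMinor G' G → Compatible M M' → (t : ℕ) →
             Σ (KModel G' t) (λ K' → Grasps M' K') →
             Σ (KModel G t) (λ K → Grasps M K)
lemma3p5 G G' M M' _ (C , Mb , ((σ , σ-inj , σ-sub) , (τ , τ-inj , τ-sub)) ,
                      (inSV , _ , _ , r≡ , s≡ , P-corr , Q-corr)) t (K' , t≤r' , t≤s' , grasp) =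
  pullback-model K' , t≤r , t≤s , grasp′
  where
  open Pullback C

  -- t ≤ r M' = r Mb ≤ r M, the last step since σ is injective; likewise for s.
  t≤r : t ≤ r M
  t≤r = ≤-trans t≤r' (subst (_≤ r M) (sym r≡) (injective⇒≤ σ-inj))

  t≤s : t ≤ s M
  t≤s = ≤-trans t≤s' (subst (_≤ s M) (sym s≡) (injective⇒≤ τ-inj))

  grasp′ : ∀ a → MeetsAtLeast t (Preimage (B K' a)) (P M) ⊎ MeetsAtLeast t (Preimage (B K' a)) (Q M)
  grasp′ a with grasp a
  ... | inj₁ meetsP = inj₁ (meets-pullback C (P M') (P Mb) (P M) r≡ σ σ-inj σ-sub
                              (λ i v onP → inSV v (inj₁ (i , onP)))
                              (λ i i' eq → proj₁ (P-corr i i' eq)) meetsP)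
  ... | inj₂ meetsQ = inj₂ (meets-pullback C (Q M') (Q Mb) (Q M) s≡ τ τ-inj τ-sub
                              (λ j v onQ → inSV v (inj₂ (j , onQ)))
                              (λ j j' eq → proj₁ (Q-corr j j' eq)) meetsQ)
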